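{- Let $(D,\mathbb{T})$ be a symmetric trip network. For any node $u$, there exists a schedule $S$ of $(D,\mathbb{T})$ such that every node $v$ that is reachable from $u$ in $D$ (via a walk) is $S$-reachable from $u$.
   Context: A weighted multidigraph $D=(V,E)$ has a finite node set $V$ and a finite multiset $E$ of edges $(u,v,w)$ with weight $w>0$. A trip network is a pair $(D,\mathbb{T})$ where $\mathbb{T}$ is a finite multiset of walks in $D$ (trips); every node and edge of $D$ appears in some trip. The duration $\delta(T)$ of a trip is the sum of its edge weights. A temporalisation $\tau$ assigns a real starting time $\tau(T)$ to each trip. For a trip $T=e_1,\dots,e_k$ with $e_i=(u_i,v_i,w_i)$, it induces temporal edges $(u_i,v_i,\tau(T)+\sum_{j<i}w_j,w_i)$ (tail, head, starting time, travel time). The induced temporal graph $G[D,\mathbb{T},\tau]$ has node set $V$ and all temporal edges induced by all trips. A temporal path from $u$ to $v$ is a sequence of consecutive temporal edges from $u$ to $v$ in which each edge's starting time is at least the arrival time (starting time plus travel time) of the previous one; $v$ is $\tau$-reachable from $u$ if such a path exists (every node reaches itself). A schedule $S$ is an ordering $T_1,\dots,T_{|\mathbb{T}|}$ of the trips; it induces the temporalisation $\tau_S(T_1)=0$, $\tau_S(T_{i+1})=\sum_{j=1}^{i}\delta(T_j)$; $v$ is $S$-reachable from $u$ if it is $\tau_S$-reachable. A trip network is symmetric if its trips can be grouped into disjoint pairs $(T,\overline{T})$ of two distinct members of $\mathbb{T}$ where $\overline{T}$ is the reverse of $T$, visiting the same nodes in reverse order.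
   Formalization: The edge weights are positive rationals rather than positive reals, so the starting times and travel times of the temporal edges are rational as well. -}

module Defs where

open import Data.Nat using (ℕ; zero; suc)
open import Data.Fin using (Fin; zero; suc)
open import Data.Fin.Permutation using (Permutation′; _⟨$⟩ʳ_; _⟨$⟩ˡ_)
open import Data.Rational using (ℚ; 0ℚ; _+_; _<_; _≤_)
open import Data.List using (List; []; _∷_; map; reverse)
open import Data.List.Membership.Propositional using (_∈_)
open import Data.Product using (Σ; ∃; _×_; _,_)
open import Relation.Binary.PropositionalEquality using (_≡_; _≢_)
open import Relation.Binary.Construct.Closure.ReflexiveTransitive using (Star)

record Edge (n : ℕ) : Set where
  constructor edge
  field
    tl  : Fin n
    hd  : Fin n
    w   : ℚ
    w>0 : 0ℚ < w
open Edge public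

-- A weighted multidigraph with nodes Fin n and an m-element multiset of edges,
-- given as an indexed family (parallel / equal edges are allowed).
Digraph : ℕ → ℕ → Set
Digraph n m = Fin m → Edge n

data Consecutive {n m : ℕ} (E : Digraph n m) : Fin n → List (Fin m) → Set where
  []  : ∀ {x} → Consecutive E x []
  _∷_ : ∀ {x i es} → tl (E i) ≡ x → Consecutive E (hd (E i)) es → Consecutive E x (i ∷ es)

record Walk {n m : ℕ} (E : Digraph n m) : Set where
  constructor walk
  field
    start : Fin n
    edges : List (Fin m)
    valid : Consecutive E start edges
open Walk public

nodeSeq : ∀ {n m} {E : Digraph n m} → Walk E → List (Fin n)
nodeSeq {E = E} W = start W ∷ map (λ i → hd (E i)) (edges W)

sumW : ∀ {n m} → Digraph n m → List (Fin m) → ℚ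
sumW E [] = 0ℚ
sumW E (i ∷ es) = w (E i) + sumW E es

duration : ∀ {n m} {E : Digraph n m} → Walk E → ℚ
duration {E = E} W = sumW E (edges W)

record TripNetwork (n m k : ℕ) : Set where
  field
    E       : Digraph n m
    trip    : Fin k → Walk E
    covNode : (x : Fin n) → ∃ λ t → x ∈ nodeSeq (trip t)
    covEdge : (i : Fin m) → ∃ λ t → i ∈ edges (trip t)
open TripNetwork public

IsReverse : ∀ {n m} {E : Digraph n m} → Walk E → Walk E → Set
IsReverse W' W = nodeSeq W' ≡ reverse (nodeSeq W)

-- Symmetric: trips are grouped into disjoint pairs (T, T̄) of two distinct members
-- (distinct indices), T̄ the reverse of T; encoded as a fixed-point-free involution.
Symmetric : ∀ {n m k} → TripNetwork n m k → Set
Symmetric {k = k} N =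
  Σ (Fin k → Fin k) λ σ →
    ((i : Fin k) → σ (σ i) ≡ i) ×
    ((i : Fin k) → σ i ≢ i) ×
    ((i : Fin k) → IsReverse (trip N (σ i)) (trip N i))

record TEdge (n : ℕ) : Set where
  constructor tedge
  field
    ttl    : Fin n
    thd    : Fin n
    tstart : ℚ
    ttrav  : ℚ
open TEdge public

induced : ∀ {n m} → Digraph n m → ℚ → List (Fin m) → List (TEdge n)
induced E s [] = []
induced E s (i ∷ es) = tedge (tl (E i)) (hd (E i)) s (w (E i)) ∷ induced E (s + w (E i)) es

Temporalisation : ℕ → Set
Temporalisation k = Fin k → ℚ

InG : ∀ {n m k} → TripNetwork n m k → Temporalisation k → TEdge n → Set
InG N τ e = ∃ λ t → e ∈ induced (E N) (τ t) (edges (trip N t))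

data TPath {n : ℕ} (G : TEdge n → Set) : ℚ → Fin n → Fin n → Set where
  done : ∀ {t x} → TPath G t x x
  step : ∀ {t x v} (e : TEdge n) → G e → ttl e ≡ x → t ≤ tstart e →
         TPath G (tstart e + ttrav e) (thd e) v → TPath G t x v

τReachable : ∀ {n m k} → TripNetwork n m k → Temporalisation k → Fin n → Fin n → Set
τReachable N τ u v = ∃ λ t → TPath (InG N τ) t u v

-- A schedule is an ordering of the trips: position j holds trip (S ⟨$⟩ʳ j).
Schedule : ℕ → Set
Schedule k = Permutation′ k

prefixSum : ∀ {k} → (Fin k → ℚ) → Fin k → ℚ
prefixSum f zero = 0ℚ
prefixSum f (suc i) = f zero + prefixSum (λ j → f (suc j)) i

τS : ∀ {n m k} → TripNetwork n m k → Schedule k → Temporalisation k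
τS N S t = prefixSum (λ j → duration (trip N (S ⟨$⟩ʳ j))) (S ⟨$⟩ˡ t)

SReachable : ∀ {n m k} → TripNetwork n m k → Schedule k → Fin n → Fin n → Set
SReachable N S = τReachable N (τS N S)

Adj : ∀ {n m} → Digraph n m → Fin n → Fin n → Set
Adj E x y = ∃ λ i → tl (E i) ≡ x × hd (E i) ≡ y

Reachable : ∀ {n m} → Digraph n m → Fin n → Fin n → Set
Reachable E = Star (Adj E)

-- Greedy tour. Call a node visited if it is u or lies on an already scheduled trip,
-- and repeatedly schedule an unscheduled trip T meeting a visited node z, immediately
-- followed by its reverse T̄. Riding T from z reaches every node after z on T; T̄ then
-- passes z again and reaches every node before it. So, with all trips scheduled back
-- to back from time 0, every visited node is reached by the end of the tour. When no
-- unscheduled trip meets a visited node, the visited nodes are closed under edges,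
-- since every edge lies on a trip; hence they contain all nodes reachable from u, and
-- the remaining trips can be appended in any order.

module Submission where

open import Defs
open import Data.Nat using (ℕ; suc) renaming (_<_ to _<ℕ_)
open import Data.Nat.Induction using (<-wellFounded)
import Data.Nat.Properties as ℕ
open import Data.Fin using (Fin; zero; suc; toℕ; cast; _≟_)
open import Data.Fin.Properties using (toℕ-cast; cast-involutive)
open import Data.Fin.Permutation using (permutation; _⟨$⟩ʳ_; _⟨$⟩ˡ_)
open import Data.Rational using (ℚ; 0ℚ; _+_; _≤_)
open import Data.Rational.Properties
  using (≤-refl; ≤-trans; <⇒≤; +-mono-≤; +-monoʳ-≤; +-assoc; +-identityˡ; +-identityʳ)
open import Data.List using (List; []; _∷_; _++_; [_]; map; reverse; length; take; lookup; allFin)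
open import Data.List.Properties
  using (∷-injectiveʳ; ++-conicalʳ; ++-assoc; reverse-++; unfold-reverse; length-tabulate)
open import Data.List.Membership.Propositional using (_∈_; find; lose)
open import Data.List.Membership.Propositional.Properties
  using (∈-++⁺ˡ; ∈-++⁺ʳ; ∈-++⁻; ∈-∃++; ∈-allFin; ∈-lookup)
import Data.List.Membership.DecPropositional as DecMembership
open import Data.List.Membership.Setoid.Properties using (unique⇒irrelevant)
open import Data.List.Relation.Unary.Any using (Any; here; there; any?; index)
open import Data.List.Relation.Unary.Any.Properties using (lookup-index; ++⁻; reverse⁺; reverse⁻)
open import Data.List.Relation.Unary.All as All using (All; []; _∷_)
import Data.List.Relation.Unary.All.Properties as All
open import Data.List.Relation.Unary.Unique.Propositional using (Unique; _∷_)
open import Data.List.Relation.Unary.Unique.Propositional.Properties using (allFin⁺)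
open import Data.List.Relation.Binary.Permutation.Propositional
  using (_↭_; ↭-refl; ↭-sym; ↭-trans; ↭-prep; ↭⇒↭ₛ)
open import Data.List.Relation.Binary.Permutation.Propositional.Properties
  using (∈-resp-↭; ↭-length; shift; ++⁺ˡ)
open import Data.List.Relation.Binary.Permutation.Setoid.Properties using (Unique-resp-↭)
open import Data.Product using (∃; _×_; _,_)
import Data.Product as Product
open import Data.Sum using (_⊎_; inj₁; inj₂)
open import Function using (_∘_)
open import Induction.WellFounded using (Acc; acc)
open import Axiom.UniquenessOfIdentityProofs using (module Decidable⇒UIP)
open import Relation.Nullary using (¬_; Dec; yes; no; contradiction)
open import Relation.Nullary.Decidable using (_⊎-dec_)
open import Relation.Binary.PropositionalEquality
  using (_≡_; _≢_; refl; sym; trans; cong; subst; setoid; module ≡-Reasoning)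
open import Relation.Binary.Construct.Closure.ReflexiveTransitive using (ε; _◅_)

p≤p+q : ∀ p {q} → 0ℚ ≤ q → p ≤ p + q
p≤p+q p 0≤q = subst (_≤ p + _) (+-identityʳ p) (+-monoʳ-≤ p 0≤q)

sumW-nonNeg : ∀ {n m} (E : Digraph n m) es → 0ℚ ≤ sumW E es
sumW-nonNeg E []       = ≤-refl
sumW-nonNeg E (i ∷ es) = +-mono-≤ (<⇒≤ (w>0 (E i))) (sumW-nonNeg E es)

sumBy : ∀ {A : Set} → (A → ℚ) → List A → ℚ
sumBy f []       = 0ℚ
sumBy f (x ∷ xs) = f x + sumBy f xs

sumBy-++ : ∀ {A : Set} (f : A → ℚ) xs {ys} → sumBy f (xs ++ ys) ≡ sumBy f xs + sumBy f ys
sumBy-++ f []       = sym (+-identityˡ _)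
sumBy-++ f (x ∷ xs) = trans (cong (f x +_) (sumBy-++ f xs)) (sym (+-assoc (f x) _ _))

sumBy-∷ʳ : ∀ {A : Set} (f : A → ℚ) xs y → sumBy f (xs ++ [ y ]) ≡ sumBy f xs + f y
sumBy-∷ʳ f xs y = trans (sumBy-++ f xs) (cong (sumBy f xs +_) (+-identityʳ (f y)))

sumBy-∷ʳ-∷ʳ : ∀ {A : Set} (f : A → ℚ) xs y z → sumBy f (xs ++ y ∷ z ∷ []) ≡ sumBy f xs + f y + f z
sumBy-∷ʳ-∷ʳ f xs y z = begin
  sumBy f (xs ++ y ∷ z ∷ [])       ≡⟨ cong (sumBy f) (sym (++-assoc xs [ y ] [ z ])) ⟩
  sumBy f ((xs ++ [ y ]) ++ [ z ]) ≡⟨ sumBy-∷ʳ f (xs ++ [ y ]) z ⟩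
  sumBy f (xs ++ [ y ]) + f z      ≡⟨ cong (_+ f z) (sumBy-∷ʳ f xs y) ⟩
  sumBy f xs + f y + f z           ∎
  where open ≡-Reasoning

reverse-around : ∀ {A : Set} (pre : List A) z post →
                 reverse (pre ++ z ∷ post) ≡ reverse post ++ z ∷ reverse pre
reverse-around pre z post = begin
  reverse (pre ++ z ∷ post)              ≡⟨ reverse-++ pre (z ∷ post) ⟩
  reverse (z ∷ post) ++ reverse pre      ≡⟨ cong (_++ reverse pre) (unfold-reverse z post) ⟩
  (reverse post ++ [ z ]) ++ reverse pre ≡⟨ ++-assoc (reverse post) [ z ] (reverse pre) ⟩
  reverse post ++ z ∷ reverse pre        ∎
  where open ≡-Reasoning

index-∈-lookup : ∀ {A : Set} (xs : List A) i → index (∈-lookup {xs = xs} i) ≡ i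
index-∈-lookup (x ∷ xs) zero    = refl
index-∈-lookup (x ∷ xs) (suc i) = cong suc (index-∈-lookup xs i)

index-unique : ∀ {A : Set} {xs : List A} pre {x post} → xs ≡ pre ++ x ∷ post →
               Unique xs → (x∈xs : x ∈ xs) → toℕ (index x∈xs) ≡ length pre
index-unique []        refl _          (here _)    = refl
index-unique []        refl (x∉ ∷ _)   (there x∈)  = contradiction refl (All.lookup x∉ x∈)
index-unique (_ ∷ pre) refl (x∉ ∷ _)   (here refl) =
  contradiction refl (All.lookup x∉ (∈-++⁺ʳ pre (here refl)))
index-unique (_ ∷ pre) refl (_ ∷ uniq) (there x∈)  = cong suc (index-unique pre refl uniq x∈)

take-length-++ : ∀ {A : Set} (xs : List A) {ys} → take (length xs) (xs ++ ys) ≡ xs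
take-length-++ []       = refl
take-length-++ (x ∷ xs) = cong (x ∷_) (take-length-++ xs)

prefixSum-lookup : ∀ {A : Set} (f : A → ℚ) (xs : List A) {k} (k≡ : k ≡ length xs) (i : Fin k) →
                   prefixSum (f ∘ lookup xs ∘ cast k≡) i ≡ sumBy f (take (toℕ i) xs)
prefixSum-lookup f (x ∷ xs) refl zero    = refl
prefixSum-lookup f (x ∷ xs) refl (suc i) = cong (f x +_) (prefixSum-lookup f xs refl i)

Unique-++⇒disjoint : ∀ {A : Set} xs {ys} {x : A} → Unique (xs ++ ys) → x ∈ xs → ¬ x ∈ ys
Unique-++⇒disjoint (_ ∷ xs) (x∉ ∷ _)   (here refl) x∈ys = All.lookup x∉ (∈-++⁺ʳ xs x∈ys) refl
Unique-++⇒disjoint (_ ∷ xs) (_ ∷ uniq) (there x∈xs) = Unique-++⇒disjoint xs uniq x∈xs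

∈⇒↭∷ : ∀ {A : Set} {x : A} {xs} → x ∈ xs → ∃ λ ys → xs ↭ x ∷ ys
∈⇒↭∷ x∈xs with pre , post , refl ← ∈-∃++ x∈xs = pre ++ post , shift _ pre post

edge-on-walk : ∀ {n m} {E : Digraph n m} {x es i} → Consecutive E x es → i ∈ es →
               tl (E i) ∈ x ∷ map (λ j → hd (E j)) es × hd (E i) ∈ x ∷ map (λ j → hd (E j)) es
edge-on-walk (tl≡ ∷ _)   (here refl) = here tl≡ , there (here refl)
edge-on-walk (_ ∷ onward) (there i∈) = Product.map there there (edge-on-walk onward i∈)

-- Unlike TPath, an arrival is extended at its last edge, as needed when riding trips forward in time.
data Arrives {n} (G : TEdge n → Set) (u : Fin n) : ℚ → Fin n → Set where
  origin : ∀ {b} → Arrives G u b u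
  ride   : ∀ {b x} (e : TEdge n) → G e → ttl e ≡ x → Arrives G u (tstart e) x →
           tstart e + ttrav e ≤ b → Arrives G u b (thd e)

module _ {n} {G : TEdge n → Set} where

  TPath-weaken : ∀ {a b x v} → a ≤ b → TPath G b x v → TPath G a x v
  TPath-weaken a≤b done                      = done
  TPath-weaken a≤b (step e e∈G tl≡ b≤t path) = step e e∈G tl≡ (≤-trans a≤b b≤t) path

  Arrives-weaken : ∀ {u a b x} → a ≤ b → Arrives G u a x → Arrives G u b x
  Arrives-weaken a≤b origin                     = origin
  Arrives-weaken a≤b (ride e e∈G tl≡ arr t+d≤a) = ride e e∈G tl≡ arr (≤-trans t+d≤a a≤b)

  Arrives⇒TPath : ∀ {u a x v} → Arrives G u a x → TPath G a x v → ∃ λ t → TPath G t u v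
  Arrives⇒TPath origin                     path = _ , path
  Arrives⇒TPath (ride e e∈G tl≡ arr t+d≤a) path =
    Arrives⇒TPath arr (step e e∈G tl≡ ≤-refl (TPath-weaken t+d≤a path))

RunsIn : ∀ {n m} → (TEdge n → Set) → Digraph n m → ℚ → List (Fin m) → Set
RunsIn G E s es = ∀ {e} → e ∈ induced E s es → G e

module _ {n m} {G : TEdge n → Set} {u : Fin n} {E : Digraph n m} where

  -- Whoever is at node z by the walk's starting time s waits there until the walk passes z.
  ride-walk : ∀ {x es s} → Consecutive E x es → RunsIn G E s es →
              ∀ pre {z post} → x ∷ map (λ i → hd (E i)) es ≡ pre ++ z ∷ post →
              Arrives G u s z → All (Arrives G u (s + sumW E es)) (z ∷ post)
  ride-walk {s = s} [] runs [] refl arr = Arrives-weaken (p≤p+q s ≤-refl) arr ∷ []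
  ride-walk [] runs (_ ∷ pre) eq arr with () ← ++-conicalʳ pre _ (sym (∷-injectiveʳ eq))
  ride-walk {es = i ∷ es} {s} (tl≡ ∷ onward) runs [] refl arr =
    Arrives-weaken (p≤p+q s (sumW-nonNeg E (i ∷ es))) arr ∷
    subst (λ b → All (Arrives G u b) _) (+-assoc s (w (E i)) (sumW E es))
      (ride-walk onward (runs ∘ there) [] refl (ride _ (runs (here refl)) tl≡ arr ≤-refl))
  ride-walk {es = i ∷ es} {s} (tl≡ ∷ onward) runs (_ ∷ pre) eq arr =
    subst (λ b → All (Arrives G u b) _) (+-assoc s (w (E i)) (sumW E es))
      (ride-walk onward (runs ∘ there) pre (∷-injectiveʳ eq)
        (Arrives-weaken (p≤p+q s (<⇒≤ (w>0 (E i)))) arr))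

  -- Ride W forward from z, then ride its reverse W′ back through z to cover the nodes before z.
  round-trip : ∀ (W W′ : Walk E) {s z} → IsReverse W′ W →
               RunsIn G E s (edges W) → RunsIn G E (s + duration W) (edges W′) →
               z ∈ nodeSeq W → Arrives G u s z →
               All (Arrives G u (s + duration W + duration W′)) (nodeSeq W)
  round-trip W W′ {s} {z} W′≡rev runs runs′ z∈W arr with ∈-∃++ z∈W
  ... | pre , post , W≡ =
    subst (All _) (sym W≡)
      (All.++⁺ (All.tabulate (All.lookup back ∘ there ∘ reverse⁺)) (All.map wait forth))
    where
    forth : All (Arrives G u (s + duration W)) (z ∷ post)
    forth = ride-walk (valid W) runs pre W≡ arr
    back : All (Arrives G u (s + duration W + duration W′)) (z ∷ reverse pre)
    back = ride-walk (valid W′) runs′ (reverse post)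
             (trans W′≡rev (trans (cong reverse W≡) (reverse-around pre z post))) (All.head forth)
    wait : ∀ {y} → Arrives G u (s + duration W) y → Arrives G u (s + duration W + duration W′) y
    wait = Arrives-weaken (p≤p+q _ (sumW-nonNeg E (edges W′)))

module _ {k} {L : List (Fin k)} (L↭allFin : L ↭ allFin k) where

  ↭allFin⇒Unique : Unique L
  ↭allFin⇒Unique = Unique-resp-↭ (setoid (Fin k)) (↭⇒↭ₛ (↭-sym L↭allFin)) (allFin⁺ k)

  ↭allFin⇒complete : ∀ t → t ∈ L
  ↭allFin⇒complete t = ∈-resp-↭ (↭-sym L↭allFin) (∈-allFin t)

  private
    length-L : length L ≡ k
    length-L = trans (↭-length L↭allFin) (length-tabulate (λ t → t))

    entry : Fin k → Fin k
    entry j = lookup L (cast (sym length-L) j)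

    position : Fin k → Fin k
    position t = cast length-L (index (↭allFin⇒complete t))

    entry-position : ∀ t → entry (position t) ≡ t
    entry-position t = trans (cong (lookup L) (cast-involutive (sym length-L) length-L _))
                             (sym (lookup-index (↭allFin⇒complete t)))

    position-entry : ∀ j → position (entry j) ≡ j
    position-entry j = begin
      cast length-L (index (↭allFin⇒complete (lookup L j′)))
        ≡⟨ cong (cast length-L ∘ index) same-membership ⟩
      cast length-L (index (∈-lookup {xs = L} j′))
        ≡⟨ cong (cast length-L) (index-∈-lookup L j′) ⟩
      cast length-L j′
        ≡⟨ cast-involutive length-L (sym length-L) j ⟩
      j ∎
      where
      open ≡-Reasoning
      j′ = cast (sym length-L) j
      same-membership : ↭allFin⇒complete (lookup L j′) ≡ ∈-lookup j′
      same-membership = unique⇒irrelevant (setoid (Fin k)) (Decidable⇒UIP.≡-irrelevant _≟_)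
                          ↭allFin⇒Unique _ _

  enumerationSchedule : Schedule k
  enumerationSchedule = permutation entry position entry-position position-entry

  prefixSum-enumerationSchedule :
    ∀ (f : Fin k → ℚ) pre {t post} → L ≡ pre ++ t ∷ post →
    prefixSum (f ∘ (enumerationSchedule ⟨$⟩ʳ_)) (enumerationSchedule ⟨$⟩ˡ t) ≡ sumBy f pre
  prefixSum-enumerationSchedule f pre {t} {post} L≡ = begin
    prefixSum (f ∘ entry) (position t)            ≡⟨ prefixSum-lookup f L (sym length-L) (position t) ⟩
    sumBy f (take (toℕ (position t)) L)           ≡⟨ cong (λ i → sumBy f (take i L)) position≡ ⟩
    sumBy f (take (length pre) L)                 ≡⟨ cong (sumBy f ∘ take (length pre)) L≡ ⟩
    sumBy f (take (length pre) (pre ++ t ∷ post)) ≡⟨ cong (sumBy f) (take-length-++ pre) ⟩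
    sumBy f pre                                   ∎
    where
    open ≡-Reasoning
    position≡ : toℕ (position t) ≡ length pre
    position≡ = trans (toℕ-cast length-L _)
                      (index-unique pre L≡ ↭allFin⇒Unique (↭allFin⇒complete t))

module SymmetricTripNetwork {n m k} (N : TripNetwork n m k) (σ : Fin k → Fin k)
  (σ-involutive : ∀ t → σ (σ t) ≡ t) (σ-fixpointFree : ∀ t → σ t ≢ t)
  (σ-reverse : ∀ t → IsReverse (trip N (σ t)) (trip N t)) (u : Fin n) where

  open DecMembership (_≟_ {n}) using (_∈?_)

  nodes : Fin k → List (Fin n)
  nodes t = nodeSeq (trip N t)

  dur : Fin k → ℚ
  dur t = duration (trip N t)

  dur-nonNeg : ∀ t → 0ℚ ≤ dur t
  dur-nonNeg t = sumW-nonNeg (E N) (edges (trip N t))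

  Visited : List (Fin k) → Fin n → Set
  Visited P z = z ≡ u ⊎ Any (λ t → z ∈ nodes t) P

  Touches : List (Fin k) → Fin k → Set
  Touches P t = Any (Visited P) (nodes t)

  touches? : ∀ P t → Dec (Touches P t)
  touches? P t = any? (λ z → (z ≟ u) ⊎-dec any? (λ t′ → z ∈? nodes t′) P) (nodes t)

  data Tour : List (Fin k) → Set where
    []  : Tour []
    _▷_ : ∀ {P t} → Tour P → Touches P t → Tour (P ++ t ∷ σ t ∷ [])

  Tour-σ-closed : ∀ {P t} → Tour P → t ∈ P → σ t ∈ P
  Tour-σ-closed (_▷_ {P} tour _) t∈ with ∈-++⁻ P t∈
  ... | inj₁ t∈P                 = ∈-++⁺ˡ (Tour-σ-closed tour t∈P)
  ... | inj₂ (here refl)         = ∈-++⁺ʳ P (there (here refl))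
  ... | inj₂ (there (here refl)) = ∈-++⁺ʳ P (here (σ-involutive _))

  BackToBack : Temporalisation k → List (Fin k) → Set
  BackToBack τ P = ∀ pre t post → P ≡ pre ++ t ∷ post → τ t ≡ sumBy dur pre

  BackToBack-++ : ∀ {τ} P {Q} → BackToBack τ (P ++ Q) → BackToBack τ P
  BackToBack-++ P {Q} b2b pre t post P≡ =
    b2b pre t (post ++ Q) (trans (cong (_++ Q) P≡) (++-assoc pre (t ∷ post) Q))

  trip-runs : ∀ τ t {s} → τ t ≡ s → RunsIn (InG N τ) (E N) s (edges (trip N t))
  trip-runs τ t refl e∈ = t , e∈

  tour-arrives : ∀ {τ P} → Tour P → BackToBack τ P →
                 ∀ {z} → Visited P z → Arrives (InG N τ) u (sumBy dur P) z
  tour-arrives _ _ (inj₁ refl) = origin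
  tour-arrives {τ} (_▷_ {P} {t} tour touch) b2b {z} (inj₂ z∈) =
    subst (λ b → Arrives (InG N τ) u b z) (sym (sumBy-∷ʳ-∷ʳ dur P t (σ t))) (arrive (++⁻ P z∈))
    where
    s = sumBy dur P
    τt : τ t ≡ s
    τt = b2b P t [ σ t ] refl
    τσt : τ (σ t) ≡ s + dur t
    τσt = trans (b2b (P ++ [ t ]) (σ t) [] (sym (++-assoc P [ t ] [ σ t ]))) (sumBy-∷ʳ dur P t)
    earlier : ∀ {z} → Visited P z → Arrives (InG N τ) u s z
    earlier = tour-arrives tour (BackToBack-++ P b2b)
    round : All (Arrives (InG N τ) u (s + dur t + dur (σ t))) (nodes t)
    round = let z₀ , z₀∈t , visited = find touch in
      round-trip (trip N t) (trip N (σ t)) (σ-reverse t)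
        (trip-runs τ t τt) (trip-runs τ (σ t) τσt) z₀∈t (earlier visited)
    arrive : Any (λ t′ → z ∈ nodes t′) P ⊎ Any (λ t′ → z ∈ nodes t′) (t ∷ σ t ∷ []) →
             Arrives (InG N τ) u (s + dur t + dur (σ t)) z
    arrive (inj₁ z∈P)                 =
      Arrives-weaken (≤-trans (p≤p+q s (dur-nonNeg t)) (p≤p+q _ (dur-nonNeg (σ t)))) (earlier (inj₂ z∈P))
    arrive (inj₂ (here z∈t))          = All.lookup round z∈t
    arrive (inj₂ (there (here z∈σt))) =
      All.lookup round (reverse⁻ (subst (z ∈_) (σ-reverse t) z∈σt))

  σ-∈-untoured : ∀ {P R t} → Tour P → P ++ R ↭ allFin k → t ∈ R → σ t ∈ R
  σ-∈-untoured {P} {R} {t} tour P++R↭ t∈R with ∈-++⁻ P (↭allFin⇒complete P++R↭ (σ t))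
  ... | inj₂ σt∈R = σt∈R
  ... | inj₁ σt∈P = contradiction t∈R (Unique-++⇒disjoint P (↭allFin⇒Unique P++R↭) t∈P)
    where
    t∈P : t ∈ P
    t∈P = subst (_∈ P) (σ-involutive t) (Tour-σ-closed tour σt∈P)

  untoured-pair : ∀ {P R t} → Tour P → P ++ R ↭ allFin k → t ∈ R →
                  ∃ λ R′ → R ↭ t ∷ σ t ∷ R′
  untoured-pair {t = t} tour P++R↭ t∈R with R₁ , R↭ ← ∈⇒↭∷ t∈R
                                      with ∈-resp-↭ R↭ (σ-∈-untoured tour P++R↭ t∈R)
  ... | here σt≡t    = contradiction σt≡t (σ-fixpointFree t)
  ... | there σt∈R₁ with R₂ , R₁↭ ← ∈⇒↭∷ σt∈R₁ = R₂ , ↭-trans R↭ (↭-prep t R₁↭)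

  record MaximalTour : Set where
    field
      toured untoured : List (Fin k)
      tour            : Tour toured
      partition       : toured ++ untoured ↭ allFin k
      maximal         : ∀ {t} → t ∈ untoured → ¬ Touches toured t

  extend-tour : ∀ {P R} → Tour P → P ++ R ↭ allFin k → Acc _<ℕ_ (length R) → MaximalTour
  extend-tour {P} {R} tour P++R↭ (acc shorter) with any? (touches? P) R
  ... | no none = record { tour = tour ; partition = P++R↭ ; maximal = λ t∈R → none ∘ lose t∈R }
  ... | yes touching = let t , t∈R , touch = find touching
                           R′ , R↭ = untoured-pair tour P++R↭ t∈R
                       in extend-tour (tour ▷ touch) (partition′ R↭) (shorter (length-decreases R↭))
    where
    partition′ : ∀ {t R′} → R ↭ t ∷ σ t ∷ R′ → (P ++ t ∷ σ t ∷ []) ++ R′ ↭ allFin k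
    partition′ {t} {R′} R↭ = subst (_↭ allFin k) (sym (++-assoc P (t ∷ σ t ∷ []) R′))
                                   (↭-trans (++⁺ˡ P (↭-sym R↭)) P++R↭)
    length-decreases : ∀ {t R′} → R ↭ t ∷ σ t ∷ R′ → length R′ <ℕ length R
    length-decreases R↭ = subst (_ <ℕ_) (sym (↭-length R↭)) (ℕ.<-trans (ℕ.n<1+n _) (ℕ.n<1+n _))

  module _ (M : MaximalTour) where
    open MaximalTour M

    edge-visited : ∀ i → Visited toured (tl (E N i)) → Visited toured (hd (E N i))
    edge-visited i visited with t , i∈t ← covEdge N i
                           with edge-on-walk (valid (trip N t)) i∈t
                              | ∈-++⁻ toured (↭allFin⇒complete partition t)
    ... | _ , hd∈t | inj₁ t∈toured   = inj₂ (lose t∈toured hd∈t)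
    ... | tl∈t , _ | inj₂ t∈untoured = contradiction (lose tl∈t visited) (maximal t∈untoured)

    reachable-visited : ∀ {x y} → Reachable (E N) x y → Visited toured x → Visited toured y
    reachable-visited ε                         visited = visited
    reachable-visited ((i , refl , refl) ◅ x↝y) visited = reachable-visited x↝y (edge-visited i visited)

  reaching-schedule : ∃ λ (S : Schedule k) → ∀ v → Reachable (E N) u v → SReachable N S u v
  reaching-schedule = S , λ v u↝v →
    Arrives⇒TPath (tour-arrives tour back-to-back (reachable-visited M u↝v (inj₁ refl))) done
    where
    M : MaximalTour
    M = extend-tour [] ↭-refl (<-wellFounded _)
    open MaximalTour M
    S : Schedule k
    S = enumerationSchedule partition
    back-to-back : BackToBack (τS N S) toured
    back-to-back = BackToBack-++ toured (λ pre t post → prefixSum-enumerationSchedule partition dur pre)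

fact2 : ∀ {n m k} (N : TripNetwork n m k) → Symmetric N →
        (u : Fin n) → ∃ λ (S : Schedule k) →
          (v : Fin n) → Reachable (E N) u v → SReachable N S u v
fact2 N (σ , σ-involutive , σ-fixpointFree , σ-reverse) =
  SymmetricTripNetwork.reaching-schedule N σ σ-involutive σ-fixpointFree σ-reverse
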